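{- Let $\mathbb{F}$ be a field, let $\langle\cdot,\cdot\rangle$ be a symmetric non-degenerate bilinear form on $\mathbb{F}^d$, let $\mathcal{P}$ be a set of $n$ points in $\mathbb{F}^d$ and let $\mathcal{S}$ be a set of $n$ unit spheres in $\mathbb{F}^d$ with respect to this form. Then the incidence graph $G(\mathcal{P},\mathcal{S})$ does not contain the pattern $\Pi_{d+1}$; that is, there are no distinct points $P_1,\dots,P_{d+1}\in\mathcal{P}$ and distinct spheres $S_1,\dots,S_{d+1}\in\mathcal{S}$ such that $P_i\in S_j$ whenever $i\ge j-1$, and $P_i\notin S_{i+2}$ for every $i=1,\dots,d-1$.
   Context: The form is non-degenerate if for every $v\ne0$ there is $w$ with $\langle v,w\rangle\ne0$. The unit sphere with center $w$ is $\{x\in\mathbb{F}^d:\langle x-w,x-w\rangle=1\}$. The incidence graph is bipartite with parts $\mathcal{P},\mathcal{S}$, with $x\sim S$ iff $x\in S$. The pattern $\Pi_{d+1}$ on vertices $a_1,\dots,a_{d+1}$, $b_1,\dots,b_{d+1}$ requires $a_ib_j$ to be an edge for $i\ge j-1$ and $a_ib_{i+2}$ to be a non-edge for $i=1,\dots,d-1$, other pairs unconstrained; containing it means containing such vertices with $a_i$ among points and $b_j$ among spheres. -}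

module Defs where

open import Level using (Level; _⊔_) renaming (suc to lsuc)
open import Algebra.Bundles using (CommutativeRing)
open import Data.Nat using (ℕ; suc; _≤_) renaming (_+_ to _+ℕ_)
open import Data.Fin using (Fin; toℕ)
open import Data.Product using (Σ; ∃; _×_)
open import Relation.Binary.PropositionalEquality using (_≡_; _≢_)
open import Relation.Nullary using (¬_)

record Field (c ℓ : Level) : Set (lsuc (c ⊔ ℓ)) where
  field
    commutativeRing : CommutativeRing c ℓ
  open CommutativeRing commutativeRing public
  field
    1≉0     : ¬ (1# ≈ 0#)
    inverse : ∀ x → ¬ (x ≈ 0#) → ∃ λ y → (x * y) ≈ 1#

module Geometry {c ℓ : Level} (F : Field c ℓ) (d : ℕ) where
  open Field F

  Vect : Set c
  Vect = Fin d → Carrier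

  _≈ᵥ_ : Vect → Vect → Set ℓ
  u ≈ᵥ v = ∀ k → u k ≈ v k

  0ᵥ : Vect
  0ᵥ k = 0#

  _+ᵥ_ : Vect → Vect → Vect
  (u +ᵥ v) k = u k + v k

  _-ᵥ_ : Vect → Vect → Vect
  (u -ᵥ v) k = u k - v k

  _·ᵥ_ : Carrier → Vect → Vect
  (a ·ᵥ v) k = a * v k

  record SymBilinearForm : Set (c ⊔ ℓ) where
    field
      form      : Vect → Vect → Carrier
      form-cong : ∀ {u u′ v v′} → u ≈ᵥ u′ → v ≈ᵥ v′ → form u v ≈ form u′ v′
      symmetric : ∀ u v → form u v ≈ form v u
      additiveˡ : ∀ u u′ v → form (u +ᵥ u′) v ≈ (form u v + form u′ v)
      homogeneousˡ : ∀ a u v → form (a ·ᵥ u) v ≈ (a * form u v)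
    -- (linearity in the second argument follows from symmetry)

  NonDegenerate : SymBilinearForm → Set (c ⊔ ℓ)
  NonDegenerate B = ∀ v → ¬ (v ≈ᵥ 0ᵥ) → ∃ λ w → ¬ (SymBilinearForm.form B v w ≈ 0#)

  OnUnitSphere : SymBilinearForm → (w x : Vect) → Set ℓ
  OnUnitSphere B w x = SymBilinearForm.form B (x -ᵥ w) (x -ᵥ w) ≈ 1#

  SameSphere : SymBilinearForm → (w w′ : Vect) → Set (c ⊔ ℓ)
  SameSphere B w w′ = ∀ x → (OnUnitSphere B w x → OnUnitSphere B w′ x)
                          × (OnUnitSphere B w′ x → OnUnitSphere B w x)

  -- The incidence graph of points P and spheres (given by centers S)
  -- contains the pattern Π_{d+1}; indices are 0-based: a i = P_{i+1}, b j = S_{j+1}.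
  ContainsΠ : SymBilinearForm → {n m : ℕ} → (Fin n → Vect) → (Fin m → Vect) → Set (c ⊔ ℓ)
  ContainsΠ B {n} {m} P S =
    Σ (Fin (suc d) → Fin n) λ a → Σ (Fin (suc d) → Fin m) λ b →
      (∀ i j → i ≢ j → ¬ (P (a i) ≈ᵥ P (a j)))
    × (∀ i j → i ≢ j → ¬ SameSphere B (S (b i)) (S (b j)))
    × (∀ i j → toℕ j ≤ suc (toℕ i) → OnUnitSphere B (S (b j)) (P (a i)))
    × (∀ i j → toℕ j ≡ toℕ i +ℕ 2 → ¬ OnUnitSphere B (S (b j)) (P (a i)))

{-# OPTIONS --safe #-}
module Submission where

-- Write ‖x - s‖² for ⟨x - s, x - s⟩. Expanding gives, for points x, y and centres s, s′,
--   2⟨x - y, s′ - s⟩ = (‖x - s‖² - ‖x - s′‖²) - (‖y - s‖² - ‖y - s′‖²),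
-- so if x lies on both spheres and y on the first, the left side vanishes iff y is on the
-- second. In characteristic 2 this makes any two unit spheres through a common point equal,
-- contradicting P₁ ∈ S₁ ∩ S₂. Otherwise (0-based, points pᵢ, centres sⱼ) the functionals
-- θⱼ = ⟨·, s_{j+1} - s₀⟩, j < d, and the vectors w, p_d - p₀, …, p_d - p_{d-2} form a
-- triangular system, where ⟨w, s₁ - s₀⟩ ≠ 0 by non-degeneracy: θⱼ kills p_d - pₘ for j ≤ m
-- but not p_d - p_{j-1}, since p_{j-1} ∉ S_{j+1}. So the d functionals θⱼ on F^d have
-- trivial common kernel, yet all vanish on p_d - p_{d-1} ≠ 0. For d = 0 the form is zero
-- and no unit sphere has a point.

open import Defs
open import Level using (Level; _⊔_)
open import Algebra.Bundles using (CommutativeRing)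
open import Data.Nat using (ℕ; zero; suc; _≤_; _<_; z≤n; s≤s; s≤s⁻¹)
import Data.Nat as ℕ
import Data.Nat.Properties as ℕ
open import Data.Nat.DivMod using (_mod_; m%n<n; m<n⇒m%n≡m)
open import Data.Nat.Properties using (≤-refl; <-trans; ≤-<-trans; <⇒≤; m≤n⇒m≤1+n; m<n⇒m<1+n)
open import Data.Integer as ℤ using (ℤ; +_; -[1+_]; _⊖_)
import Data.Integer.Properties as ℤ
import Data.Sign as Sign
open import Data.Fin using (Fin; zero; suc; toℕ)
open import Data.Fin.Properties using (∀-cons; toℕ-fromℕ<)
open import Data.Vec.Functional using (Vector; insertAt; removeAt; zipWith; map; tail)
open import Data.Vec.Functional.Properties using (insertAt-removeAt)
open import Data.Maybe using (Maybe; just; nothing)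
open import Data.Empty using (⊥)
open import Data.Product using (Σ; _,_; proj₁; proj₂)
open import Function using (_∘_)
open import Relation.Nullary using (¬_; yes; no)
open import Relation.Binary.PropositionalEquality as ≡ using (_≡_; _≢_; _≗_)

insertAt-zipWith : ∀ {a b c} {A : Set a} {B : Set b} {C : Set c} {n} (f : A → B → C)
                   (u : Vector A n) (v : Vector B n) i x y →
                   insertAt (zipWith f u v) i (f x y) ≗ zipWith f (insertAt u i x) (insertAt v i y)
insertAt-zipWith         f u v zero    x y zero    = ≡.refl
insertAt-zipWith         f u v zero    x y (suc j) = ≡.refl
insertAt-zipWith {n = suc n} f u v (suc i) x y zero    = ≡.refl
insertAt-zipWith {n = suc n} f u v (suc i) x y (suc j) = insertAt-zipWith f (tail u) (tail v) i x y j

insertAt-map : ∀ {a b} {A : Set a} {B : Set b} {n} (f : A → B) (u : Vector A n) i x →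
               insertAt (map f u) i (f x) ≗ map f (insertAt u i x)
insertAt-map         f u zero    x zero    = ≡.refl
insertAt-map         f u zero    x (suc j) = ≡.refl
insertAt-map {n = suc n} f u (suc i) x zero    = ≡.refl
insertAt-map {n = suc n} f u (suc i) x (suc j) = insertAt-map f (tail u) i x j

toℕ-mod : ∀ {k n} .{{_ : ℕ.NonZero n}} → k < n → toℕ (k mod n) ≡ k
toℕ-mod {k} {n} k<n = ≡.trans (toℕ-fromℕ< (m%n<n k n)) (m<n⇒m%n≡m k<n)

¬¬-∀-Fin : ∀ n {p} {P : Fin n → Set p} → (∀ i → ¬ ¬ P i) → ¬ ¬ (∀ i → P i)
¬¬-∀-Fin zero    ¬¬P ¬∀P = ¬∀P (λ ())
¬¬-∀-Fin (suc n) ¬¬P ¬∀P = ¬¬P zero λ P₀ → ¬¬-∀-Fin n (¬¬P ∘ suc) (¬∀P ∘ ∀-cons P₀)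

-- Over an abstract ring, Tactic.RingSolver keeps coefficients in the carrier, where
-- 1# - 1# is not recognised as 0#; integer coefficients make such cancellations compute.
module IntegerCoefficientSolver {c ℓ} (R : CommutativeRing c ℓ) where
  open CommutativeRing R
  open import Algebra.Properties.Semiring.Mult.TCOptimised semiring using (_×_; ×-homo-+; ×1-homo-*; 1+×)
  open import Algebra.Properties.Ring ring using (-‿involutive; -0#≈0#; -‿distribˡ-*; -‿distribʳ-*)
  open import Algebra.Properties.AbelianGroup +-abelianGroup using (⁻¹-∙-comm; xyx⁻¹≈y)
  open import Algebra.Solver.Ring.AlmostCommutativeRing using (fromCommutativeRing; _-Raw-AlmostCommutative⟶_)
  open import Relation.Binary.Reasoning.Setoid setoid

  ⟦_⟧ : ℤ → Carrier
  ⟦ + n ⟧      = n × 1#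
  ⟦ -[1+ n ] ⟧ = - (suc n × 1#)

  ⟦-⟧ : ∀ i → ⟦ ℤ.- i ⟧ ≈ - ⟦ i ⟧
  ⟦-⟧ (+ zero)  = sym -0#≈0#
  ⟦-⟧ (+ suc n) = refl
  ⟦-⟧ -[1+ n ]  = sym (-‿involutive _)

  ⟦⊖⟧ : ∀ m n → ⟦ m ⊖ n ⟧ ≈ m × 1# - n × 1#
  ⟦⊖⟧ zero    zero    = sym (trans (+-congˡ -0#≈0#) (+-identityʳ 0#))
  ⟦⊖⟧ zero    (suc n) = sym (+-identityˡ _)
  ⟦⊖⟧ (suc m) zero    = sym (trans (+-congˡ -0#≈0#) (+-identityʳ _))
  ⟦⊖⟧ (suc m) (suc n) = begin
    ⟦ suc m ⊖ suc n ⟧               ≡⟨ ≡.cong ⟦_⟧ (ℤ.[1+m]⊖[1+n]≡m⊖n m n) ⟩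
    ⟦ m ⊖ n ⟧                       ≈⟨ ⟦⊖⟧ m n ⟩
    a - b                           ≈⟨ xyx⁻¹≈y 1# (a - b) ⟨
    1# + (a - b) - 1#               ≈⟨ +-congʳ (+-assoc 1# a (- b)) ⟨
    (1# + a) - b - 1#               ≈⟨ +-assoc _ _ _ ⟩
    (1# + a) + (- b - 1#)           ≈⟨ +-congˡ (trans (⁻¹-∙-comm b 1#) (-‿cong (+-comm b 1#))) ⟩
    (1# + a) - (1# + b)             ≈⟨ +-cong (1+× m 1#) (-‿cong (1+× n 1#)) ⟨
    suc m × 1# - suc n × 1#         ∎
    where a = m × 1#; b = n × 1#

  ⟦+⟧ : ∀ i j → ⟦ i ℤ.+ j ⟧ ≈ ⟦ i ⟧ + ⟦ j ⟧
  ⟦+⟧ (+ m)    (+ n)    = ×-homo-+ 1# m n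
  ⟦+⟧ (+ m)    -[1+ n ] = ⟦⊖⟧ m (suc n)
  ⟦+⟧ -[1+ m ] (+ n)    = trans (⟦⊖⟧ n (suc m)) (+-comm _ _)
  ⟦+⟧ -[1+ m ] -[1+ n ] = begin
    - (suc (suc (m ℕ.+ n)) × 1#)    ≡⟨ ≡.cong (λ k → - (k × 1#)) (ℕ.+-suc (suc m) n) ⟨
    - ((suc m ℕ.+ suc n) × 1#)      ≈⟨ -‿cong (×-homo-+ 1# (suc m) (suc n)) ⟩
    - (suc m × 1# + suc n × 1#)     ≈⟨ ⁻¹-∙-comm _ _ ⟨
    - (suc m × 1#) - (suc n × 1#)   ∎

  ⟦+◃⟧ : ∀ n → ⟦ Sign.+ ℤ.◃ n ⟧ ≈ n × 1#
  ⟦+◃⟧ zero    = refl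
  ⟦+◃⟧ (suc n) = refl

  ⟦-◃⟧ : ∀ n → ⟦ Sign.- ℤ.◃ n ⟧ ≈ - (n × 1#)
  ⟦-◃⟧ zero    = sym -0#≈0#
  ⟦-◃⟧ (suc n) = refl

  ⟦*⟧ : ∀ i j → ⟦ i ℤ.* j ⟧ ≈ ⟦ i ⟧ * ⟦ j ⟧
  ⟦*⟧ (+ m)    (+ n)    = trans (⟦+◃⟧ (m ℕ.* n)) (×1-homo-* m n)
  ⟦*⟧ (+ m)    -[1+ n ] = begin
    ⟦ Sign.- ℤ.◃ (m ℕ.* suc n) ⟧    ≈⟨ ⟦-◃⟧ (m ℕ.* suc n) ⟩
    - ((m ℕ.* suc n) × 1#)          ≈⟨ -‿cong (×1-homo-* m (suc n)) ⟩
    - ((m × 1#) * (suc n × 1#))     ≈⟨ -‿distribʳ-* _ _ ⟩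
    (m × 1#) * - (suc n × 1#)       ∎
  ⟦*⟧ -[1+ m ] (+ n)    = begin
    ⟦ Sign.- ℤ.◃ (suc m ℕ.* n) ⟧    ≈⟨ ⟦-◃⟧ (suc m ℕ.* n) ⟩
    - ((suc m ℕ.* n) × 1#)          ≈⟨ -‿cong (×1-homo-* (suc m) n) ⟩
    - ((suc m × 1#) * (n × 1#))     ≈⟨ -‿distribˡ-* _ _ ⟩
    - (suc m × 1#) * (n × 1#)       ∎
  ⟦*⟧ -[1+ m ] -[1+ n ] = begin
    ⟦ Sign.+ ℤ.◃ (suc m ℕ.* suc n) ⟧ ≈⟨ ⟦+◃⟧ (suc m ℕ.* suc n) ⟩
    (suc m ℕ.* suc n) × 1#          ≈⟨ ×1-homo-* (suc m) (suc n) ⟩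
    x * y                           ≈⟨ -‿involutive _ ⟨
    - - (x * y)                     ≈⟨ -‿cong (-‿distribˡ-* x y) ⟩
    - (- x * y)                     ≈⟨ -‿distribʳ-* (- x) y ⟩
    - x * - y                       ∎
    where x = suc m × 1#; y = suc n × 1#

  ℤ⟶R : ℤ.+-*-rawRing -Raw-AlmostCommutative⟶ fromCommutativeRing R
  ℤ⟶R = record
    { ⟦_⟧ = ⟦_⟧ ; +-homo = ⟦+⟧ ; *-homo = ⟦*⟧ ; -‿homo = ⟦-⟧
    ; 0-homo = refl ; 1-homo = refl }

  ⟦_⟧≟⟦_⟧ : ∀ i j → Maybe (⟦ i ⟧ ≈ ⟦ j ⟧)
  ⟦ i ⟧≟⟦ j ⟧ with i ℤ.≟ j
  ... | yes ≡.refl = just refl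
  ... | no _       = nothing

  open import Algebra.Solver.Ring ℤ.+-*-rawRing (fromCommutativeRing R) ℤ⟶R ⟦_⟧≟⟦_⟧ public
    using (solve; _:=_; _:+_; _:*_; _:-_; con)

module Incidences {c ℓ} (F : Field c ℓ) where
  open Field F hiding (zero)
  open IntegerCoefficientSolver commutativeRing using (solve; _:=_; _:+_; _:*_; _:-_; con)
  open import Algebra.Properties.Ring ring using (-0#≈0#; -1*x≈-x)
  open import Algebra.Properties.Group +-group using (x∙y⁻¹≈ε⇒x≈y; x≈y⇒x∙y⁻¹≈ε)
  open import Relation.Binary.Reasoning.Setoid setoid
  open Geometry F using (Vect)
  private module _ {d : ℕ} where open Geometry F d public using (_≈ᵥ_; 0ᵥ; _+ᵥ_; _-ᵥ_; _·ᵥ_)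

  x*y≈0⇒y≈0 : ∀ {x y} → ¬ x ≈ 0# → x * y ≈ 0# → y ≈ 0#
  x*y≈0⇒y≈0 {x} {y} x≉0 xy≈0 = begin
    y              ≈⟨ *-identityˡ y ⟨
    1# * y         ≈⟨ *-congʳ (trans (*-comm x⁻¹ x) xx⁻¹≈1) ⟨
    x⁻¹ * x * y    ≈⟨ *-assoc x⁻¹ x y ⟩
    x⁻¹ * (x * y)  ≈⟨ *-congˡ xy≈0 ⟩
    x⁻¹ * 0#       ≈⟨ zeroʳ x⁻¹ ⟩
    0#             ∎
    where open Σ (inverse x x≉0) renaming (proj₁ to x⁻¹; proj₂ to xx⁻¹≈1)

  insertAt-cong : ∀ {d} {u v : Vect d} {a b} → u ≈ᵥ v → a ≈ b →
                  ∀ i → insertAt u i a ≈ᵥ insertAt v i b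
  insertAt-cong         u≈v a≈b zero    zero    = a≈b
  insertAt-cong         u≈v a≈b zero    (suc j) = u≈v j
  insertAt-cong {suc d} u≈v a≈b (suc i) zero    = u≈v zero
  insertAt-cong {suc d} u≈v a≈b (suc i) (suc j) = insertAt-cong (u≈v ∘ suc) a≈b i j

  record Functional (d : ℕ) : Set (c ⊔ ℓ) where
    field
      fun      : Vect d → Carrier
      fun-cong : ∀ {u v} → u ≈ᵥ v → fun u ≈ fun v
      fun-+    : ∀ u v → fun (u +ᵥ v) ≈ fun u + fun v
      fun-·    : ∀ a u → fun (a ·ᵥ u) ≈ a * fun u
  open Functional

  module _ {d : ℕ} (ψ : Functional d) where

    fun-0ᵥ : ∀ {v} → v ≈ᵥ 0ᵥ → fun ψ v ≈ 0#
    fun-0ᵥ {v} v≈0 = begin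
      fun ψ v          ≈⟨ fun-cong ψ (λ k → trans (v≈0 k) (sym (zeroˡ (v k)))) ⟩
      fun ψ (0# ·ᵥ v)  ≈⟨ fun-· ψ 0# v ⟩
      0# * fun ψ v     ≈⟨ zeroˡ _ ⟩
      0#               ∎

    fun-sub : ∀ u v → fun ψ (u -ᵥ v) ≈ fun ψ u - fun ψ v
    fun-sub u v = begin
      fun ψ (u -ᵥ v)                  ≈⟨ fun-cong ψ (λ k → +-congˡ (-1*x≈-x (v k))) ⟨
      fun ψ (u +ᵥ ((- 1#) ·ᵥ v))      ≈⟨ fun-+ ψ u _ ⟩
      fun ψ u + fun ψ ((- 1#) ·ᵥ v)   ≈⟨ +-congˡ (trans (fun-· ψ (- 1#) v) (-1*x≈-x _)) ⟩
      fun ψ u - fun ψ v               ∎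

    fun-annihilated : ∀ {u} → fun ψ u ≈ 0# → ∀ a x → fun ψ (x -ᵥ (a ·ᵥ u)) ≈ fun ψ x
    fun-annihilated {u} ψu≈0 a x = begin
      fun ψ (x -ᵥ (a ·ᵥ u))       ≈⟨ fun-sub x (a ·ᵥ u) ⟩
      fun ψ x - fun ψ (a ·ᵥ u)    ≈⟨ +-congˡ (-‿cong (trans (fun-· ψ a u) (*-congˡ ψu≈0))) ⟩
      fun ψ x - a * 0#            ≈⟨ +-congˡ (-‿cong (zeroʳ a)) ⟩
      fun ψ x - 0#                ≈⟨ trans (+-congˡ -0#≈0#) (+-identityʳ _) ⟩
      fun ψ x                     ∎

  restrict : ∀ {d} → Fin (suc d) → Functional (suc d) → Functional d
  restrict i ψ = record
    { fun      = λ v → fun ψ (insertAt v i 0#)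
    ; fun-cong = λ u≈v → fun-cong ψ (insertAt-cong u≈v refl i)
    ; fun-+    = λ u v → trans (fun-cong ψ λ k →
                   trans (insertAt-cong (λ _ → refl) (sym (+-identityʳ 0#)) i k)
                         (reflexive (insertAt-zipWith _+_ u v i 0# 0# k)))
                   (fun-+ ψ _ _)
    ; fun-·    = λ a u → trans (fun-cong ψ λ k →
                   trans (insertAt-cong (λ _ → refl) (sym (zeroʳ a)) i k)
                         (reflexive (insertAt-map (a *_) u i 0# k)))
                   (fun-· ψ _ _)
    }

  -- With a the inverse of u i, this clears coordinate i of x along u and then drops it.
  eliminate : ∀ {d} → Fin (suc d) → Carrier → Vect (suc d) → Vect (suc d) → Vect d
  eliminate i a u x = removeAt (x -ᵥ ((x i * a) ·ᵥ u)) i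

  restrict-eliminate : ∀ {d} (ψ : Functional (suc d)) {i a u} → u i * a ≈ 1# → fun ψ u ≈ 0# →
                       ∀ x → fun (restrict i ψ) (eliminate i a u x) ≈ fun ψ x
  restrict-eliminate ψ {i} {a} {u} ua≈1 ψu≈0 x = begin
    fun ψ (insertAt (removeAt y i) i 0#)  ≈⟨ fun-cong ψ insertAt-removeAt-y ⟩
    fun ψ y                               ≈⟨ fun-annihilated ψ ψu≈0 (x i * a) x ⟩
    fun ψ x                               ∎
    where
    y = x -ᵥ ((x i * a) ·ᵥ u)
    xau≈x : x i * a * u i ≈ x i
    xau≈x = begin
      x i * a * u i    ≈⟨ *-assoc (x i) a (u i) ⟩
      x i * (a * u i)  ≈⟨ *-congˡ (trans (*-comm a (u i)) ua≈1) ⟩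
      x i * 1#         ≈⟨ *-identityʳ (x i) ⟩
      x i              ∎
    insertAt-removeAt-y : insertAt (removeAt y i) i 0# ≈ᵥ y
    insertAt-removeAt-y k = trans
      (insertAt-cong (λ _ → refl) (sym (trans (+-congˡ (-‿cong xau≈x)) (-‿inverseʳ (x i)))) i k)
      (reflexive (insertAt-removeAt y i k))

  record TriangularSystem {d} (n : ℕ) (ψ : ℕ → Functional d) (z : ℕ → Vect d) : Set ℓ where
    field
      upper-zero       : ∀ {j k} → j < k → k < n → fun (ψ j) (z k) ≈ 0#
      diagonal-nonzero : ∀ {j} → j < n → ¬ fun (ψ j) (z j) ≈ 0#
  open TriangularSystem

  triangular-init : ∀ {d n ψ} {z : ℕ → Vect d} → TriangularSystem (suc n) ψ z → TriangularSystem n ψ z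
  triangular-init T = record
    { upper-zero       = λ j<k k<n → upper-zero T j<k (m<n⇒m<1+n k<n)
    ; diagonal-nonzero = λ j<n → diagonal-nonzero T (m<n⇒m<1+n j<n)
    }

  triangular-eliminate : ∀ {d n ψ z} {u : Vect (suc d)} {i a} → TriangularSystem n ψ z →
                         u i * a ≈ 1# → (∀ {j} → j < n → fun (ψ j) u ≈ 0#) →
                         TriangularSystem n (restrict i ∘ ψ) (eliminate i a u ∘ z)
  triangular-eliminate {ψ = ψ} {z} T ua≈1 ψu≈0 = record
    { upper-zero       = λ j<k k<n →
        trans (restrict-eliminate (ψ _) ua≈1 (ψu≈0 (<-trans j<k k<n)) (z _)) (upper-zero T j<k k<n)
    ; diagonal-nonzero = λ j<n →
        diagonal-nonzero T j<n ∘ trans (sym (restrict-eliminate (ψ _) ua≈1 (ψu≈0 j<n) (z _)))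
    }

  -- Pivot on a coordinate of u assumed nonzero (found only under ¬¬, as ≈ is undecidable);
  -- the last vector of the eliminated system then plays the role of u.
  triangular⇒kernel-trivial : ∀ d {ψ z} {u : Vect d} → TriangularSystem d ψ z →
                              (∀ {j} → j < d → fun (ψ j) u ≈ 0#) → ¬ ¬ (u ≈ᵥ 0ᵥ)
  triangular⇒kernel-trivial zero    _ _ u≉0 = u≉0 (λ ())
  triangular⇒kernel-trivial (suc d) {ψ} {u = u} T ψu≈0 = ¬¬-∀-Fin (suc d) coordinate-zero
    where
    coordinate-zero : ∀ i → ¬ ¬ (u i ≈ 0#)
    coordinate-zero i ui≉0 =
      triangular⇒kernel-trivial d (triangular-init T′) (λ j<d → upper-zero T′ j<d ≤-refl)
        (diagonal-nonzero T′ ≤-refl ∘ fun-0ᵥ (restrict i (ψ d)))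
      where T′ = triangular-eliminate T (proj₂ (inverse (u i) ui≉0)) ψu≈0

  -- The solver constant con (+ 2) evaluates to exactly this term.
  two : Carrier
  two = 1# + 1#

  module Spheres {d : ℕ} (B : Geometry.SymBilinearForm F d) where
    open Geometry F d using (OnUnitSphere; SameSphere)
    open Geometry.SymBilinearForm B

    ⟨-,_⟩ : Vect d → Functional d
    ⟨-, v ⟩ = record
      { fun      = λ u → form u v
      ; fun-cong = λ u≈u′ → form-cong u≈u′ (λ _ → refl)
      ; fun-+    = λ u u′ → additiveˡ u u′ v
      ; fun-·    = λ a u → homogeneousˡ a u v
      }

    form-subʳ : ∀ u v w → form u (v -ᵥ w) ≈ form u v - form u w
    form-subʳ u v w = begin
      form u (v -ᵥ w)        ≈⟨ symmetric u _ ⟩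
      form (v -ᵥ w) u        ≈⟨ fun-sub ⟨-, u ⟩ v w ⟩
      form v u - form w u    ≈⟨ +-cong (symmetric v u) (-‿cong (symmetric w u)) ⟩
      form u v - form u w    ∎

    sqDist : Vect d → Vect d → Carrier
    sqDist x s = form (x -ᵥ s) (x -ᵥ s)

    form-sub-sub : ∀ x y s s′ →
                   form (x -ᵥ y) (s′ -ᵥ s) ≈ (form x s′ - form x s) - (form y s′ - form y s)
    form-sub-sub x y s s′ =
      trans (fun-sub ⟨-, s′ -ᵥ s ⟩ x y) (+-cong (form-subʳ x s′ s) (-‿cong (form-subʳ y s′ s)))

    sqDist-expand : ∀ x s → sqDist x s ≈ (form x x - form x s) - (form x s - form s s)
    sqDist-expand x s = trans (form-sub-sub x s s x)
      (+-congˡ (-‿cong (+-congʳ (symmetric s x))))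

    twice-form-sub-sub : ∀ x y s s′ →
      two * form (x -ᵥ y) (s′ -ᵥ s) ≈ (sqDist x s - sqDist x s′) - (sqDist y s - sqDist y s′)
    twice-form-sub-sub x y s s′ = begin
      two * form (x -ᵥ y) (s′ -ᵥ s)
        ≈⟨ *-congˡ (form-sub-sub x y s s′) ⟩
      two * ((form x s′ - form x s) - (form y s′ - form y s))
        ≈⟨ solve 8 (λ xx xs xs′ yy ys ys′ ss s′s′ →
             con (+ 2) :* ((xs′ :- xs) :- (ys′ :- ys))
             := (((xx :- xs) :- (xs :- ss)) :- ((xx :- xs′) :- (xs′ :- s′s′)))
                :- (((yy :- ys) :- (ys :- ss)) :- ((yy :- ys′) :- (ys′ :- s′s′))))
             refl (form x x) (form x s) (form x s′) (form y y) (form y s) (form y s′) (form s s) (form s′ s′) ⟩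
      (((form x x - form x s) - (form x s - form s s)) - ((form x x - form x s′) - (form x s′ - form s′ s′)))
        - (((form y y - form y s) - (form y s - form s s)) - ((form y y - form y s′) - (form y s′ - form s′ s′)))
        ≈⟨ +-cong (+-cong (sqDist-expand x s) (-‿cong (sqDist-expand x s′)))
                  (-‿cong (+-cong (sqDist-expand y s) (-‿cong (sqDist-expand y s′)))) ⟨
      (sqDist x s - sqDist x s′) - (sqDist y s - sqDist y s′)
        ∎

    twice-form-sub-sub-incident : ∀ {x y s s′} →
                                  OnUnitSphere B s x → OnUnitSphere B s′ x → OnUnitSphere B s y →
                                  two * form (x -ᵥ y) (s′ -ᵥ s) ≈ sqDist y s′ - 1#
    twice-form-sub-sub-incident {x} {y} {s} {s′} x∈S x∈S′ y∈S = begin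
      two * form (x -ᵥ y) (s′ -ᵥ s)                            ≈⟨ twice-form-sub-sub x y s s′ ⟩
      (sqDist x s - sqDist x s′) - (sqDist y s - sqDist y s′)
        ≈⟨ +-cong (+-cong x∈S (-‿cong x∈S′)) (-‿cong (+-congʳ y∈S)) ⟩
      (1# - 1#) - (1# - sqDist y s′)
        ≈⟨ solve 2 (λ o q → (o :- o) :- (o :- q) := q :- o) refl 1# (sqDist y s′) ⟩
      sqDist y s′ - 1#                                         ∎

    form-sub-sub-zero : ∀ {x y s s′} → ¬ two ≈ 0# →
                        OnUnitSphere B s x → OnUnitSphere B s′ x →
                        OnUnitSphere B s y → OnUnitSphere B s′ y →
                        form (x -ᵥ y) (s′ -ᵥ s) ≈ 0#
    form-sub-sub-zero 2≉0 x∈S x∈S′ y∈S y∈S′ =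
      x*y≈0⇒y≈0 2≉0 (trans (twice-form-sub-sub-incident x∈S x∈S′ y∈S) (x≈y⇒x∙y⁻¹≈ε y∈S′))

    form-sub-sub-nonzero : ∀ {x y s s′} →
                           OnUnitSphere B s x → OnUnitSphere B s′ x →
                           OnUnitSphere B s y → ¬ OnUnitSphere B s′ y →
                           ¬ form (x -ᵥ y) (s′ -ᵥ s) ≈ 0#
    form-sub-sub-nonzero x∈S x∈S′ y∈S y∉S′ form≈0 = y∉S′ (x∙y⁻¹≈ε⇒x≈y _ _ (begin
      _                    ≈⟨ twice-form-sub-sub-incident x∈S x∈S′ y∈S ⟨
      two * _              ≈⟨ *-congˡ form≈0 ⟩
      two * 0#             ≈⟨ zeroʳ two ⟩
      0#                   ∎))

    sqDist≈⇒SameSphere : ∀ {s s′} → (∀ x → sqDist x s ≈ sqDist x s′) → SameSphere B s s′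
    sqDist≈⇒SameSphere eq x = (λ x∈S → trans (sym (eq x)) x∈S) , (λ x∈S′ → trans (eq x) x∈S′)

    ≈ᵥ⇒SameSphere : ∀ {s s′} → s ≈ᵥ s′ → SameSphere B s s′
    ≈ᵥ⇒SameSphere s≈s′ = sqDist≈⇒SameSphere λ x →
      let x-s≈x-s′ = λ k → +-congˡ (-‿cong (s≈s′ k)) in form-cong x-s≈x-s′ x-s≈x-s′

    -- In characteristic 2 the difference sqDist x s - sqDist x s′ does not depend on x.
    two≈0⇒SameSphere : ∀ {p s s′} → two ≈ 0# →
                       OnUnitSphere B s p → OnUnitSphere B s′ p → SameSphere B s s′
    two≈0⇒SameSphere {p} {s} {s′} 2≈0 p∈S p∈S′ = sqDist≈⇒SameSphere λ x →
      x∙y⁻¹≈ε⇒x≈y _ _ (begin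
        sqDist x s - sqDist x s′
          ≈⟨ solve 2 (λ a o → a := a :- (o :- o)) refl _ 1# ⟩
        (sqDist x s - sqDist x s′) - (1# - 1#)
          ≈⟨ +-congˡ (-‿cong (+-cong p∈S (-‿cong p∈S′))) ⟨
        (sqDist x s - sqDist x s′) - (sqDist p s - sqDist p s′)
          ≈⟨ twice-form-sub-sub x p s s′ ⟨
        two * form (x -ᵥ p) (s′ -ᵥ s)
          ≈⟨ *-congʳ 2≈0 ⟩
        0# * form (x -ᵥ p) (s′ -ᵥ s)
          ≈⟨ zeroˡ _ ⟩
        0# ∎)

  module Staircase {d′ : ℕ} (B : Geometry.SymBilinearForm F (suc d′))
    (nondegenerate : Geometry.NonDegenerate F (suc d′) B)
    (point sphere : ℕ → Vect (suc d′))
    (incident : ∀ {i j} → i ≤ suc d′ → j ≤ suc d′ → j ≤ suc i →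
                Geometry.OnUnitSphere F (suc d′) B (sphere j) (point i))
    (not-incident : ∀ {i} → suc (suc i) ≤ suc d′ →
                    ¬ Geometry.OnUnitSphere F (suc d′) B (sphere (suc (suc i))) (point i))
    (points-distinct : ¬ point (suc d′) ≈ᵥ point d′)
    (spheres-distinct : ¬ Geometry.SameSphere F (suc d′) B (sphere 0) (sphere 1))
    where
    open Geometry.SymBilinearForm B
    open Spheres B

    d : ℕ
    d = suc d′

    two≉0 : ¬ two ≈ 0#
    two≉0 2≈0 = spheres-distinct
      (two≈0⇒SameSphere 2≈0 (incident z≤n z≤n z≤n) (incident z≤n (s≤s z≤n) (s≤s z≤n)))

    centres-distinct : ¬ (sphere 1 -ᵥ sphere 0) ≈ᵥ 0ᵥ
    centres-distinct s₁-s₀≈0 =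
      spheres-distinct (≈ᵥ⇒SameSphere (λ k → sym (x∙y⁻¹≈ε⇒x≈y _ _ (s₁-s₀≈0 k))))

    θ : ℕ → Functional d
    θ j = ⟨-, sphere (suc j) -ᵥ sphere 0 ⟩

    z : ℕ → Vect d
    z zero    = proj₁ (nondegenerate _ centres-distinct)
    z (suc m) = point d -ᵥ point m

    θ-vanishes : ∀ {j m} → j ≤ m → m < d → fun (θ j) (point d -ᵥ point m) ≈ 0#
    θ-vanishes j≤m m<d = form-sub-sub-zero two≉0
      (incident ≤-refl z≤n z≤n) (incident ≤-refl j<d (m≤n⇒m≤1+n j<d))
      (incident (<⇒≤ m<d) z≤n z≤n) (incident (<⇒≤ m<d) j<d (s≤s j≤m))
      where j<d = ≤-<-trans j≤m m<d

    staircase : TriangularSystem d θ z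
    staircase = record { upper-zero = upper-zero′ ; diagonal-nonzero = diagonal-nonzero′ }
      where
      upper-zero′ : ∀ {j k} → j < k → k < d → fun (θ j) (z k) ≈ 0#
      upper-zero′ {k = suc m} (s≤s j≤m) m+1<d = θ-vanishes j≤m (<⇒≤ m+1<d)

      diagonal-nonzero′ : ∀ {j} → j < d → ¬ fun (θ j) (z j) ≈ 0#
      diagonal-nonzero′ {zero}  _     = proj₂ (nondegenerate _ centres-distinct) ∘ trans (symmetric _ _)
      diagonal-nonzero′ {suc m} m+1<d = form-sub-sub-nonzero
        (incident ≤-refl z≤n z≤n) (incident ≤-refl m+1<d (m≤n⇒m≤1+n m+1<d))
        (incident (<⇒≤ (<⇒≤ m+1<d)) z≤n z≤n) (not-incident m+1<d)

    contradiction : ⊥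
    contradiction = triangular⇒kernel-trivial d staircase
      (λ j<d → θ-vanishes (s≤s⁻¹ j<d) ≤-refl)
      (λ u≈0 → points-distinct (λ k → x∙y⁻¹≈ε⇒x≈y _ _ (u≈0 k)))

  ¬containsΠ : ∀ d (B : Geometry.SymBilinearForm F d) → Geometry.NonDegenerate F d B →
               ∀ {n} (P S : Fin n → Vect d) → ¬ Geometry.ContainsΠ F d B P S
  ¬containsΠ zero B _ P S (_ , _ , _ , _ , incident , _) =
    1≉0 (trans (sym (incident zero zero z≤n)) (fun-0ᵥ ⟨-, _ ⟩ (λ ())))
    where open Spheres B
  ¬containsΠ (suc d′) B nondegenerate P S
             (a , b , points-distinct , spheres-distinct , incident , not-incident) =
    Staircase.contradiction B nondegenerate point sphere incident′ not-incident′
      (points-distinct (index (suc d′)) (index d′) index-d≢index-d′)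
      (spheres-distinct zero (suc zero) (λ ()))
    where
    open Geometry F (suc d′) using (OnUnitSphere)

    index : ℕ → Fin (suc (suc d′))
    index k = k mod suc (suc d′)

    toℕ-index : ∀ {k} → k ≤ suc d′ → toℕ (index k) ≡ k
    toℕ-index k≤d = toℕ-mod (s≤s k≤d)

    point sphere : ℕ → Vect (suc d′)
    point  = P ∘ a ∘ index
    sphere = S ∘ b ∘ index

    incident′ : ∀ {i j} → i ≤ suc d′ → j ≤ suc d′ → j ≤ suc i →
                OnUnitSphere B (sphere j) (point i)
    incident′ {i} {j} i≤d j≤d j≤i+1 = incident (index i) (index j)
      (≡.subst₂ _≤_ (≡.sym (toℕ-index j≤d)) (≡.cong suc (≡.sym (toℕ-index i≤d))) j≤i+1)

    not-incident′ : ∀ {i} → suc (suc i) ≤ suc d′ → ¬ OnUnitSphere B (sphere (suc (suc i))) (point i)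
    not-incident′ {i} i+2≤d = not-incident (index i) (index (suc (suc i)))
      (≡.trans (toℕ-index i+2≤d)
               (≡.trans (ℕ.+-comm 2 i) (≡.cong (ℕ._+ 2) (≡.sym (toℕ-index (<⇒≤ (<⇒≤ i+2≤d)))))))

    index-d≢index-d′ : index (suc d′) ≢ index d′
    index-d≢index-d′ eq = ℕ.1+n≢n (≡.trans (≡.sym (toℕ-index ≤-refl))
                                     (≡.trans (≡.cong toℕ eq) (toℕ-index (ℕ.n≤1+n d′))))

lemma5p5 : ∀ {c ℓ : Level} (F : Field c ℓ) (d : ℕ)
           (B : Geometry.SymBilinearForm F d) → Geometry.NonDegenerate F d B →
           (n : ℕ) (P : Fin n → Geometry.Vect F d) (S : Fin n → Geometry.Vect F d) →
           ¬ Geometry.ContainsΠ F d B P S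
lemma5p5 F d B nondegenerate n P S = Incidences.¬containsΠ F d B nondegenerate P S
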